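{- Let $\Gamma=(\mathcal{P},\mathcal{L},\mathtt{I})$ be a finite weak generalised $2m$-gon of order $(s,t)$, $m\ge2$. Let $C$ be a set of points with $|C|<s+1$ and let $d\in\{1,\dots,m-1\}$. Then: (i) for every line $L$ there exists a line $M\in\mathcal{L}_{\le 2d-2}(L)$ with $C\cap\mathcal{P}_{\le 2d-1}(M)=C\cap\mathcal{P}_1(L)$; (ii) for every line $L$ there exists a point $v\in\mathcal{P}_{\le 2d-1}(L)$ with $C\cap\mathcal{P}_{\le 2d}(v)=C\cap\mathcal{P}_1(L)$.
   Context: A weak generalised $n$-gon ($n\ge3$) is a point-line geometry (points, lines, symmetric incidence; elements are points or lines) with no ordinary $k$-gon as subgeometry for $2\le k<n$ and in which any two elements lie in a common ordinary $n$-gon. $\delta$ is distance in the bipartite incidence graph. Order $(s,t)$: each line has $s+1$ points, each point is on $t+1$ lines. For an element $x$: $\mathcal{P}_i(x)$, $\mathcal{P}_{\le i}(x)$ are the sets of points at distance exactly $i$, resp. at most $i$, from $x$; $\mathcal{L}_{\le i}(x)$ is the set of lines at distance at most $i$ from $x$. $\mathcal{P}_1(L)$ is the set of points on the line $L$. -}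

module Defs where

open import Data.Nat using (ℕ; zero; suc; _+_; _*_; _≤_; _<_)
open import Data.Fin using (Fin)
open import Data.Bool using (Bool; T)
open import Data.Sum using (_⊎_; inj₁; inj₂)
open import Data.Product using (Σ; ∃; _×_; _,_)
open import Data.Empty using (⊥)
open import Relation.Nullary using (¬_)
open import Relation.Binary.PropositionalEquality using (_≡_)
open import Function.Bundles using (_↔_)

-- A finite point-line geometry: points Fin np, lines Fin nl,
-- incidence I p L (decidable, Bool-valued; symmetric incidence is
-- represented by a single relation between points and lines).
Incidence : ℕ → ℕ → Set
Incidence np nl = Fin np → Fin nl → Bool

Elem : ℕ → ℕ → Set
Elem np nl = Fin np ⊎ Fin nl

pt : ∀ {np nl} → Fin np → Elem np nl
pt = inj₁

ln : ∀ {np nl} → Fin nl → Elem np nl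
ln = inj₂

Adj : ∀ {np nl} → Incidence np nl → Elem np nl → Elem np nl → Set
Adj I (inj₁ p) (inj₂ L) = T (I p L)
Adj I (inj₂ L) (inj₁ p) = T (I p L)
Adj I (inj₁ _) (inj₁ _) = ⊥
Adj I (inj₂ _) (inj₂ _) = ⊥

data Walk {np nl} (I : Incidence np nl) : Elem np nl → Elem np nl → ℕ → Set where
  here : ∀ {x} → Walk I x x 0
  step : ∀ {x y z k} → Adj I x y → Walk I y z k → Walk I x z (suc k)

DistLE : ∀ {np nl} → Incidence np nl → Elem np nl → Elem np nl → ℕ → Set
DistLE I x y k = Σ ℕ λ j → j ≤ k × Walk I x y j

record OrdinaryPolygon {np nl} (I : Incidence np nl) (k : ℕ) : Set where
  field
    vert     : ℕ → Elem np nl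
    adjacent : ∀ i → Adj I (vert i) (vert (suc i))
    periodic : ∀ i → vert (i + 2 * k) ≡ vert i
    distinct : ∀ i j → i < 2 * k → j < 2 * k → vert i ≡ vert j → i ≡ j

OnPolygon : ∀ {np nl} {I : Incidence np nl} {k} → OrdinaryPolygon I k → Elem np nl → Set
OnPolygon P x = ∃ λ i → OrdinaryPolygon.vert P i ≡ x

record WeakGenPolygon {np nl} (I : Incidence np nl) (n : ℕ) : Set where
  field
    n≥3      : 3 ≤ n
    noSmall  : ∀ k → 2 ≤ k → k < n → ¬ OrdinaryPolygon I k
    twoInGon : ∀ x y → Σ (OrdinaryPolygon I n) λ P → OnPolygon P x × OnPolygon P y

HasOrder : ∀ {np nl} → Incidence np nl → ℕ → ℕ → Set
HasOrder {np} {nl} I s t =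
  (∀ L → Fin (suc s) ↔ Σ (Fin np) (λ p → T (I p L))) ×
  (∀ p → Fin (suc t) ↔ Σ (Fin nl) (λ L → T (I p L)))

{-# OPTIONS --safe #-}

-- Induction on d, carrying a line K with δ(L,K) ≤ 2d−2 such that every point of C within
-- distance 2d−1 of K lies on L. Call a point x of K b-exposed if some line N ≠ K through x
-- lies within distance b of a point c ∈ C off L. For b ≤ 2d+1 such a c is at distance at
-- least b from K (point-line distances are odd), and if two distinct points of K had the
-- same witness c, shortest paths from c would close up into an ordinary k-gon with k < 2m.
-- So the witnesses are distinct, and as K has s+1 > |C| points, some point x of K is not
-- b-exposed. For b = 2d−1 this x is the point of (ii); for b = 2d+1, any line through x
-- other than K (there is one, as x lies on an ordinary polygon) is the line of stage d+1.

module Submission where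

open import Defs
open import Data.Bool using (Bool; true; false; T; not; _xor_)
open import Data.Bool.Properties
  using (T?; T-irrelevant; not-¬; not-distribˡ-xor; not-distribʳ-xor; xor-identityʳ; not-involutive)
open import Data.Empty using (⊥-elim)
open import Data.Fin as Fin using (Fin; toℕ; fromℕ<)
import Data.Fin.Properties as Finₚ
open import Data.Fin.Subset using (Subset; _∈_; ∣_∣; _-_)
open import Data.Fin.Subset.Properties
  using (_∈?_; x∈p∧x∉q⇒x∈p─q; x∈⁅y⁆⇒x≡y; x∈p⇒∣p-x∣<∣p∣)
open import Data.Nat using (ℕ; zero; suc; pred; _+_; _*_; _∸_; _≤_; _<_; z≤n; s≤s; _≤?_; _<?_)
open import Data.Nat.Properties
open import Data.Nat.DivMod
  using (_%_; _/_; m%n<n; m<n⇒m%n≡m; n%n≡0; %-distribˡ-+; [m+n]%n≡m%n; m≡m%n+[m/n]*n)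
open import Data.Nat.Divisibility using (divides; ∣⇒≤)
open import Data.Product using (Σ; _×_; _,_; proj₁; proj₂; map₂)
open import Data.Sum using (inj₁; inj₂)
open import Data.Sum.Properties using (≡-dec; inj₁-injective; inj₂-injective)
open import Function.Base using (_∘_)
open import Function.Bundles using (_↔_; _⇔_; mk⇔; Inverse; Injection)
open import Function.Properties.Inverse using (↔⇒↣)
open import Relation.Nullary using (¬_; ¬?; Dec; yes; no; contradiction)
open import Relation.Nullary.Decidable using (map′; _×-dec_; _⊎-dec_; decidable-stable)
open import Relation.Binary.PropositionalEquality

injection⇒≤∣∣ : ∀ {k n} (C : Subset n) (f : Fin k → Fin n) → (∀ a → f a ∈ C) →
                (∀ {a a'} → f a ≡ f a' → a ≡ a') → k ≤ ∣ C ∣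
injection⇒≤∣∣ {zero}  C f f∈C f-inj = z≤n
injection⇒≤∣∣ {suc k} C f f∈C f-inj =
  ≤-trans (s≤s (injection⇒≤∣∣ (C - f Fin.zero) (f ∘ Fin.suc) f∘suc∈C-f0
                                (Finₚ.suc-injective ∘ f-inj)))
          (x∈p⇒∣p-x∣<∣p∣ (f∈C Fin.zero))
  where
  f∘suc∈C-f0 : ∀ a → f (Fin.suc a) ∈ C - f Fin.zero
  f∘suc∈C-f0 a = x∈p∧x∉q⇒x∈p─q (f∈C (Fin.suc a))
                   (λ h → Finₚ.0≢1+n (sym (f-inj (x∈⁅y⁆⇒x≡y _ h))))

module Walks {np nl : ℕ} (I : Incidence np nl) where

  E : Set
  E = Elem np nl

  _≟E_ : (x y : E) → Dec (x ≡ y)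
  _≟E_ = ≡-dec Fin._≟_ Fin._≟_

  Adj-sym : ∀ {x y} → Adj I x y → Adj I y x
  Adj-sym {inj₁ _} {inj₂ _} a = a
  Adj-sym {inj₂ _} {inj₁ _} a = a

  Adj? : ∀ x y → Dec (Adj I x y)
  Adj? (inj₁ p) (inj₂ L) = T? (I p L)
  Adj? (inj₂ L) (inj₁ p) = T? (I p L)
  Adj? (inj₁ _) (inj₁ _) = no λ ()
  Adj? (inj₂ _) (inj₂ _) = no λ ()

  infixr 5 _++_
  infixl 5 _∷ʳ_

  _++_ : ∀ {x y z j k} → Walk I x y j → Walk I y z k → Walk I x z (j + k)
  here     ++ w = w
  step e v ++ w = step e (v ++ w)

  _∷ʳ_ : ∀ {x y z k} → Walk I x y k → Adj I y z → Walk I x z (suc k)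
  here      ∷ʳ e = step e here
  step e' w ∷ʳ e = step e' (w ∷ʳ e)

  reverse : ∀ {x y k} → Walk I x y k → Walk I y x k
  reverse here               = here
  reverse (step {x} {y} e w) = reverse w ∷ʳ Adj-sym {x} {y} e

  unsnoc : ∀ {x z k} → Walk I x z (suc k) → Σ E λ y → Walk I x y k × Adj I y z
  unsnoc (step e here)        = _ , here , e
  unsnoc (step e (step e' w)) with unsnoc (step e' w)
  ... | y , w' , e'' = y , step e w' , e''

  ∃? : {P : E → Set} → (∀ x → Dec (P x)) → Dec (Σ E P)
  ∃? P? = map′ (λ { (inj₁ (p , h)) → inj₁ p , h ; (inj₂ (L , h)) → inj₂ L , h })
               (λ { (inj₁ p , h) → inj₁ (p , h) ; (inj₂ L , h) → inj₂ (L , h) })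
               (Finₚ.any? (λ p → P? (inj₁ p)) ⊎-dec Finₚ.any? (λ L → P? (inj₂ L)))

  Walk? : ∀ k x y → Dec (Walk I x y k)
  Walk? zero    x y = map′ (λ { refl → here }) (λ { here → refl }) (x ≟E y)
  Walk? (suc k) x y = map′ (λ (z , e , w) → step e w) (λ { (step e w) → _ , e , w })
                           (∃? λ z → Adj? x z ×-dec Walk? k z y)

  DistLE? : ∀ x y k → Dec (DistLE I x y k)
  DistLE? x y k =
    map′ (λ (j , w) → toℕ j , Finₚ.toℕ≤pred[n] j , w)
         (λ (j , j≤k , w) → fromℕ< (s≤s j≤k) ,
                             subst (Walk I x y) (sym (Finₚ.toℕ-fromℕ< (s≤s j≤k))) w)
         (Finₚ.any? λ (j : Fin (suc k)) → Walk? (toℕ j) x y)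

  DistLE-refl : ∀ {x} → DistLE I x x 0
  DistLE-refl = 0 , z≤n , here

  DistLE-mono : ∀ {x y k k'} → k ≤ k' → DistLE I x y k → DistLE I x y k'
  DistLE-mono k≤k' (j , j≤k , w) = j , ≤-trans j≤k k≤k' , w

  DistLE-sym : ∀ {x y k} → DistLE I x y k → DistLE I y x k
  DistLE-sym (j , j≤k , w) = j , j≤k , reverse w

  DistLE-∷ : ∀ {x y z k} → Adj I x y → DistLE I y z k → DistLE I x z (suc k)
  DistLE-∷ e (j , j≤k , w) = suc j , s≤s j≤k , step e w

  DistLE-∷ʳ : ∀ {x y z k} → DistLE I x y k → Adj I y z → DistLE I x z (suc k)
  DistLE-∷ʳ (j , j≤k , w) e = suc j , s≤s j≤k , w ∷ʳ e

  DistGE : E → E → ℕ → Set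
  DistGE x y k = ∀ j → Walk I x y j → k ≤ j

  DistGE-weaken : ∀ {x y k k'} → k' ≤ k → DistGE x y k → DistGE x y k'
  DistGE-weaken k'≤k far j w = ≤-trans k'≤k (far j w)

  ¬DistLE⇒DistGE : ∀ {x y k} → ¬ DistLE I x y k → DistGE x y (suc k)
  ¬DistLE⇒DistGE ¬near j w = ≰⇒> λ j≤k → ¬near (j , j≤k , w)

  shortest : ∀ {x y k} → DistLE I x y k → Σ ℕ λ D → D ≤ k × Walk I x y D × DistGE x y D
  shortest {k = zero} (zero , _ , w) = 0 , z≤n , w , λ _ _ → z≤n
  shortest {k = zero} (suc _ , () , _)
  shortest {x} {y} {suc k} (j , j≤1+k , w) with DistLE? x y k
  ... | yes near = let D , D≤k , wD , far = shortest near in D , m≤n⇒m≤1+n D≤k , wD , far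
  ... | no ¬near = j , j≤1+k , w , λ j' w' → ≤-trans j≤1+k (¬DistLE⇒DistGE ¬near j' w')

  side : E → Bool
  side (inj₁ _) = false
  side (inj₂ _) = true

  parity : ℕ → Bool
  parity zero    = false
  parity (suc k) = not (parity k)

  parity-2* : ∀ i → parity (2 * i) ≡ false
  parity-2* zero = refl
  parity-2* (suc i) = trans (cong parity (*-suc 2 i)) (trans (not-involutive _) (parity-2* i))

  Adj-side : ∀ {x y} → Adj I x y → side y ≡ not (side x)
  Adj-side {inj₁ _} {inj₂ _} _ = refl
  Adj-side {inj₂ _} {inj₁ _} _ = refl

  Walk-side : ∀ {x y k} → Walk I x y k → side y ≡ parity k xor side x
  Walk-side here = refl
  Walk-side {x} {y} {suc k} (step {y = z} e w) = begin
    side y                    ≡⟨ Walk-side w ⟩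
    parity k xor side z       ≡⟨ cong (parity k xor_) (Adj-side {x} {z} e) ⟩
    parity k xor not (side x) ≡⟨ sym (not-distribʳ-xor (parity k) (side x)) ⟩
    not (parity k xor side x) ≡⟨ not-distribˡ-xor (parity k) (side x) ⟩
    not (parity k) xor side x ∎
    where open ≡-Reasoning

  point-line-DistGE : ∀ {p L} i → DistGE (pt p) (ln L) (2 * i) →
                      DistGE (pt p) (ln L) (suc (2 * i))
  point-line-DistGE i far j w = ≤∧≢⇒< (far j w) λ 2i≡j →
    contradiction (trans (sym (parity-2* i)) (trans (cong parity 2i≡j) odd)) λ ()
    where
    odd : parity j ≡ true
    odd = trans (sym (xor-identityʳ (parity j))) (sym (Walk-side w))

  DistGE-past-neighbour : ∀ {c y z k} → Walk I c z k → Adj I z y →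
                          DistGE c y k → DistGE c y (suc k)
  DistGE-past-neighbour {z = z} wz e far j wy = ≤∧≢⇒< (far j wy) λ { refl →
    not-¬ (trans (Walk-side wy) (sym (Walk-side wz))) (Adj-side {z} e) }

module Polygons {np nl : ℕ} (I : Incidence np nl) where
  open Walks I

  record IsPath (p : ℕ → E) (k : ℕ) : Set where
    field
      adjacent  : ∀ j → j < k → Adj I (p j) (p (suc j))
      injective : ∀ {j j'} → j ≤ k → j' ≤ k → p j ≡ p j' → j ≡ j'

  IsPath-shift : ∀ {p S K} i → i + K ≤ S → IsPath p S → IsPath (λ j → p (i + j)) K
  IsPath-shift {p} {S} {K} i i+K≤S path = record
    { adjacent  = λ j j<K → subst (Adj I (p (i + j)) ∘ p) (sym (+-suc i j))
                              (adjacent (i + j) (subst (_≤ S) (+-suc i j) (within j<K)))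
    ; injective = λ j≤K j'≤K eq → +-cancelˡ-≡ i _ _ (injective (within j≤K) (within j'≤K) eq)
    }
    where
    open IsPath path
    within : ∀ {j} → j ≤ K → i + j ≤ S
    within j≤K = ≤-trans (+-monoʳ-≤ i j≤K) i+K≤S

  closed-path⇒polygon : ∀ k (h : ℕ → E) →
    (∀ r → r < 2 * suc k → Adj I (h r) (h (suc r))) → h (2 * suc k) ≡ h 0 →
    (∀ {r r'} → r < 2 * suc k → r' < 2 * suc k → h r ≡ h r' → r ≡ r') →
    OrdinaryPolygon I (suc k)
  closed-path⇒polygon k h h-adjacent closed h-injective = record
    { vert     = λ i → h (i % N)
    ; adjacent = λ i → subst (Adj I (h (i % N)) ∘ h) (sym (suc-% i)) (step-% (i % N) (m%n<n i N))
    ; periodic = λ i → cong h ([m+n]%n≡m%n i N)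
    ; distinct = λ i j i<N j<N eq →
        subst₂ _≡_ (m<n⇒m%n≡m i<N) (m<n⇒m%n≡m j<N) (h-injective (m%n<n i N) (m%n<n j N) eq)
    }
    where
    N : ℕ
    N = 2 * suc k

    suc-% : ∀ i → suc i % N ≡ suc (i % N) % N
    suc-% i = trans (%-distribˡ-+ 1 i N) (cong (λ x → (x + i % N) % N) (m<n⇒m%n≡m 1<N))
      where
      1<N : 1 < N
      1<N = s≤s (≤-trans (s≤s z≤n) (m≤n+m _ k))

    step-% : ∀ r → r < N → Adj I (h r) (h (suc r % N))
    step-% r r<N with m≤n⇒m<n∨m≡n r<N
    ... | inj₁ 1+r<N = subst (Adj I (h r) ∘ h) (sym (m<n⇒m%n≡m 1+r<N)) (h-adjacent r r<N)
    ... | inj₂ 1+r≡N = subst (Adj I (h r)) wrap (h-adjacent r r<N)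
      where
      open ≡-Reasoning
      wrap : h (suc r) ≡ h (suc r % N)
      wrap = begin
        h (suc r)     ≡⟨ cong h 1+r≡N ⟩
        h N           ≡⟨ closed ⟩
        h 0           ≡⟨ cong h (sym (n%n≡0 N)) ⟩
        h (N % N)     ≡⟨ cong (λ x → h (x % N)) (sym 1+r≡N) ⟩
        h (suc r % N) ∎

  two-paths⇒polygon : ∀ k {p q} → IsPath p (suc k) → IsPath q (suc k) →
    p 0 ≡ q 0 → p (suc k) ≡ q (suc k) →
    (∀ {j j'} → j ≤ suc k → 0 < j' → j' < suc k → p j ≢ q j') →
    OrdinaryPolygon I (suc k)
  two-paths⇒polygon k {p} {q} p-path q-path start end disjoint =
    closed-path⇒polygon k h h-adjacent h-closed h-injective
    where
    K N : ℕ
    K = suc k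
    N = 2 * K

    N∸K≡K : N ∸ K ≡ K
    N∸K≡K = trans (m+n∸m≡n K (K + 0)) (+-identityʳ K)

    high-index : ∀ {r} → K < r → r ≤ N → N ∸ r < K
    high-index {r} K<r r≤N = subst (N ∸ r <_) N∸K≡K (∸-monoʳ-< K<r r≤N)

    h : ℕ → E
    h r with r ≤? K
    ... | yes _ = p r
    ... | no  _ = q (N ∸ r)

    h-low : ∀ {r} → r ≤ K → h r ≡ p r
    h-low {r} r≤K with r ≤? K
    ... | yes _   = refl
    ... | no  r≰K = contradiction r≤K r≰K

    h-high : ∀ {r} → K ≤ r → h r ≡ q (N ∸ r)
    h-high {r} K≤r with r ≤? K
    ... | no _ = refl
    ... | yes r≤K with ≤-antisym r≤K K≤r
    ...   | refl = trans end (cong q (sym N∸K≡K))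

    h-adjacent : ∀ r → r < N → Adj I (h r) (h (suc r))
    h-adjacent r r<N with K ≤? r
    ... | no  K≰r = subst₂ (Adj I) (sym (h-low (<⇒≤ 1+r≤K))) (sym (h-low 1+r≤K))
                      (IsPath.adjacent p-path r 1+r≤K)
      where
      1+r≤K : suc r ≤ K
      1+r≤K = ≰⇒> K≰r
    ... | yes K≤r = subst₂ (Adj I) (sym (trans (h-high K≤r) (cong q (+-∸-assoc 1 r<N))))
                      (sym (h-high (m≤n⇒m≤1+n K≤r)))
                      (Adj-sym {q (N ∸ suc r)} {q (suc (N ∸ suc r))}
                        (IsPath.adjacent q-path _ (high-index (s≤s K≤r) r<N)))

    h-closed : h N ≡ h 0
    h-closed = trans (h-high (m≤m+n K (K + 0)))
                     (trans (cong q (n∸n≡0 N)) (trans (sym start) (sym (h-low z≤n))))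

    h-injective : ∀ {r r'} → r < N → r' < N → h r ≡ h r' → r ≡ r'
    h-injective {r} {r'} r<N r'<N eq with K <? r | K <? r'
    ... | no K≮r | no K≮r' =
      IsPath.injective p-path (≮⇒≥ K≮r) (≮⇒≥ K≮r')
        (trans (sym (h-low (≮⇒≥ K≮r))) (trans eq (h-low (≮⇒≥ K≮r'))))
    ... | yes K<r | yes K<r' =
      ∸-cancelˡ-≡ (<⇒≤ r<N) (<⇒≤ r'<N)
        (IsPath.injective q-path (<⇒≤ (high-index K<r (<⇒≤ r<N)))
                                 (<⇒≤ (high-index K<r' (<⇒≤ r'<N)))
          (trans (sym (h-high (<⇒≤ K<r))) (trans eq (h-high (<⇒≤ K<r')))))
    ... | no K≮r | yes K<r' = contradiction
      (trans (sym (h-low (≮⇒≥ K≮r))) (trans eq (h-high (<⇒≤ K<r'))))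
      (disjoint (≮⇒≥ K≮r) (m<n⇒0<n∸m r'<N) (high-index K<r' (<⇒≤ r'<N)))
    ... | yes K<r | no K≮r' = contradiction
      (trans (sym (h-low (≮⇒≥ K≮r'))) (trans (sym eq) (h-high (<⇒≤ K<r))))
      (disjoint (≮⇒≥ K≮r') (m<n⇒0<n∸m r<N) (high-index K<r (<⇒≤ r<N)))

  TwoNeighbours : E → Set
  TwoNeighbours x = Σ E λ u → Σ E λ w → Adj I u x × Adj I x w × u ≢ w

  module _ {k} (P : OrdinaryPolygon I (suc (suc k))) where
    open OrdinaryPolygon P

    private
      N : ℕ
      N = 2 * suc (suc k)

    vert-+* : ∀ r q → vert (r + q * N) ≡ vert r
    vert-+* r zero    = cong vert (+-identityʳ r)
    vert-+* r (suc q) = begin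
      vert (r + (N + q * N)) ≡⟨ cong vert (trans (cong (r +_) (+-comm N (q * N)))
                                                 (sym (+-assoc r (q * N) N))) ⟩
      vert (r + q * N + N)   ≡⟨ periodic (r + q * N) ⟩
      vert (r + q * N)       ≡⟨ vert-+* r q ⟩
      vert r                 ∎
      where open ≡-Reasoning

    vert-% : ∀ i → vert i ≡ vert (i % N)
    vert-% i = trans (cong vert (m≡m%n+[m/n]*n i N)) (vert-+* (i % N) (i / N))

    -- Vertices two steps apart are congruent modulo N only if N divides 2.
    vert≢vert-2+ : ∀ j → vert j ≢ vert (2 + j)
    vert≢vert-2+ j eq = <⇒≱ 2<N (∣⇒≤ (divides Q 2≡Q*N))
      where
      open ≡-Reasoning
      r Q : ℕ
      r = j % N
      Q = (2 + r) / N

      2<N : 2 < N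
      2<N = s≤s (s≤s (≤-trans (s≤s z≤n) (m≤n+m _ k)))

      r≡[2+r]%N : r ≡ (2 + r) % N
      r≡[2+r]%N = distinct r ((2 + r) % N) (m%n<n j N) (m%n<n (2 + r) N) (begin
        vert r                   ≡⟨ sym (vert-% j) ⟩
        vert j                   ≡⟨ eq ⟩
        vert (2 + j)             ≡⟨ cong (λ x → vert (2 + x)) (m≡m%n+[m/n]*n j N) ⟩
        vert (2 + r + j / N * N) ≡⟨ vert-+* (2 + r) (j / N) ⟩
        vert (2 + r)             ≡⟨ vert-% (2 + r) ⟩
        vert ((2 + r) % N)       ∎)

      2≡Q*N : 2 ≡ Q * N
      2≡Q*N = +-cancelˡ-≡ r 2 (Q * N) (begin
        r + 2               ≡⟨ +-comm r 2 ⟩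
        2 + r               ≡⟨ m≡m%n+[m/n]*n (2 + r) N ⟩
        (2 + r) % N + Q * N ≡⟨ cong (_+ Q * N) (sym r≡[2+r]%N) ⟩
        r + Q * N           ∎)

    vert-suc-two-neighbours : ∀ {x} j → vert (suc j) ≡ x → TwoNeighbours x
    vert-suc-two-neighbours j refl =
      vert j , vert (2 + j) , adjacent j , adjacent (suc j) , vert≢vert-2+ j

    polygon-two-neighbours : ∀ {x} → OnPolygon P x → TwoNeighbours x
    polygon-two-neighbours (zero  , v0≡x) = vert-suc-two-neighbours (pred N) (trans (periodic 0) v0≡x)
    polygon-two-neighbours (suc j , vj≡x) = vert-suc-two-neighbours j vj≡x

  another-line : ∀ {k} → 2 ≤ k → (∀ x → Σ (OrdinaryPolygon I k) λ P → OnPolygon P (pt x)) →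
    ∀ x K → Σ (Fin nl) λ N → N ≢ K × T (I x N)
  another-line (s≤s (s≤s _)) on-polygon x K
    with polygon-two-neighbours (proj₁ (on-polygon x)) (proj₂ (on-polygon x))
  ... | inj₁ _ , _ , () , _
  ... | inj₂ _ , inj₁ _ , _ , () , _
  ... | inj₂ N₁ , inj₂ N₂ , xN₁ , xN₂ , N₁≢N₂ with N₁ Fin.≟ K
  ...   | no  N₁≢K = N₁ , N₁≢K , xN₁
  ...   | yes refl = N₂ , (λ N₂≡K → N₁≢N₂ (cong inj₂ (sym N₂≡K))) , xN₂

module Geodesics {np nl : ℕ} (I : Incidence np nl) where
  open Walks I
  open Polygons I

  record WalkSeq (c z : E) (S : ℕ) : Set where
    field
      vertex   : ℕ → E
      start    : vertex 0 ≡ c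
      end      : vertex S ≡ z
      adjacent : ∀ l → l < S → Adj I (vertex l) (vertex (suc l))

  open WalkSeq

  vertexAt : ∀ {x y k} → Walk I x y k → ℕ → E
  vertexAt {x} here       _       = x
  vertexAt {x} (step _ _) zero    = x
  vertexAt     (step _ w) (suc l) = vertexAt w l

  vertexAt-0 : ∀ {x y k} (w : Walk I x y k) → vertexAt w 0 ≡ x
  vertexAt-0 here       = refl
  vertexAt-0 (step _ _) = refl

  vertexAt-end : ∀ {x y k} (w : Walk I x y k) → vertexAt w k ≡ y
  vertexAt-end here       = refl
  vertexAt-end (step _ w) = vertexAt-end w

  vertexAt-adjacent : ∀ {x y k} (w : Walk I x y k) →
                      ∀ l → l < k → Adj I (vertexAt w l) (vertexAt w (suc l))
  vertexAt-adjacent (step {x} e w) zero    _         = subst (Adj I x) (sym (vertexAt-0 w)) e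
  vertexAt-adjacent (step e w)     (suc l) (s≤s l<k) = vertexAt-adjacent w l l<k

  vertexAt-penultimate : ∀ {x y z k} (w : Walk I x y k) (e : Adj I y z) → vertexAt (w ∷ʳ e) k ≡ y
  vertexAt-penultimate here       e = refl
  vertexAt-penultimate (step _ w) e = vertexAt-penultimate w e

  toWalkSeq : ∀ {c z S} → Walk I c z S → WalkSeq c z S
  toWalkSeq w = record
    { vertex   = vertexAt w
    ; start    = vertexAt-0 w
    ; end      = vertexAt-end w
    ; adjacent = vertexAt-adjacent w
    }

  module _ {c z S} (g : WalkSeq c z S) where

    segment : ∀ a k → a + k ≤ S → Walk I (vertex g a) (vertex g (a + k)) k
    segment a zero    _     = subst (λ l → Walk I (vertex g a) (vertex g l) 0) (sym (+-identityʳ a)) here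
    segment a (suc k) a+k<S = step (adjacent g a (≤-trans (s≤s (m≤m+n a k)) a+1+k≤S))
      (subst (λ l → Walk I (vertex g (suc a)) (vertex g l) k) (sym (+-suc a k))
             (segment (suc a) k a+1+k≤S))
      where
      a+1+k≤S : suc a + k ≤ S
      a+1+k≤S = subst (_≤ S) (+-suc a k) a+k<S

    prefix : ∀ l → l ≤ S → Walk I c (vertex g l) l
    prefix l l≤S = subst (λ x → Walk I x (vertex g l) l) (start g) (segment 0 l l≤S)

    suffix : ∀ l → l ≤ S → Walk I (vertex g l) z (S ∸ l)
    suffix l l≤S = subst (λ x → Walk I (vertex g l) x (S ∸ l))
                         (trans (cong (vertex g) l+[S∸l]≡S) (end g))
                         (segment l (S ∸ l) (≤-reflexive l+[S∸l]≡S))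
      where
      l+[S∸l]≡S : l + (S ∸ l) ≡ S
      l+[S∸l]≡S = m+[n∸m]≡n l≤S

    prefix-DistGE : DistGE c z S → ∀ l → l ≤ S → DistGE c (vertex g l) l
    prefix-DistGE far l l≤S j w = +-cancelʳ-≤ (S ∸ l) l j
      (subst (_≤ j + (S ∸ l)) (sym (m+[n∸m]≡n l≤S)) (far _ (w ++ suffix l l≤S)))

  index-unique : ∀ {c z S} → DistGE c z S → (g g' : WalkSeq c z S) →
    ∀ {l l'} → l ≤ S → l' ≤ S → vertex g l ≡ vertex g' l' → l ≡ l'
  index-unique {c} far g g' {l} {l'} l≤S l'≤S eq = ≤-antisym
    (prefix-DistGE g  far l  l≤S  l' (subst (λ x → Walk I c x l') (sym eq) (prefix g' l' l'≤S)))
    (prefix-DistGE g' far l' l'≤S l  (subst (λ x → Walk I c x l) eq (prefix g l l≤S)))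

  geodesic-IsPath : ∀ {c z S} → DistGE c z S → (g : WalkSeq c z S) → IsPath (vertex g) S
  geodesic-IsPath far g = record { adjacent = adjacent g ; injective = index-unique far g g }

  last-agreement : (f g : ℕ → E) → f 0 ≡ g 0 → ∀ u →
    Σ ℕ λ i → i ≤ u × f i ≡ g i × (∀ {l} → i < l → l ≤ u → f l ≢ g l)
  last-agreement f g agree₀ zero = 0 , z≤n , agree₀ , λ 0<l l≤0 → ⊥-elim (<⇒≱ 0<l l≤0)
  last-agreement f g agree₀ (suc u) with f (suc u) ≟E g (suc u)
  ... | yes agree = suc u , ≤-refl , agree , λ 1+u<l l≤1+u → ⊥-elim (<⇒≱ 1+u<l l≤1+u)
  ... | no differ with last-agreement f g agree₀ u
  ...   | i , i≤u , agree , apart = i , m≤n⇒m≤1+n i≤u , agree , apart′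
    where
    apart′ : ∀ {l} → i < l → l ≤ suc u → f l ≢ g l
    apart′ i<l l≤1+u with m≤n⇒m<n∨m≡n l≤1+u
    ... | inj₁ l<1+u = apart i<l (≤-pred l<1+u)
    ... | inj₂ refl  = differ

  rejoining-geodesics⇒polygon : ∀ {c z S} → DistGE c z S → (g₁ g₂ : WalkSeq c z S) →
    ∀ i k → i + suc k ≡ S → vertex g₁ i ≡ vertex g₂ i →
    (∀ {l} → i < l → l < S → vertex g₁ l ≢ vertex g₂ l) → OrdinaryPolygon I (suc k)
  rejoining-geodesics⇒polygon {c} {z} {S} far g₁ g₂ i k i+K≡S meet apart =
    two-paths⇒polygon k (arm g₁) (arm g₂)
      (agree-at (+-identityʳ i) meet) (agree-at i+K≡S (trans (end g₁) (sym (end g₂))))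
      disjoint
    where
    within : ∀ {j} → j ≤ suc k → i + j ≤ S
    within j≤K = subst (_ ≤_) i+K≡S (+-monoʳ-≤ i j≤K)

    arm : (g : WalkSeq c z S) → IsPath (λ j → vertex g (i + j)) (suc k)
    arm g = IsPath-shift i (≤-reflexive i+K≡S) (geodesic-IsPath far g)

    agree-at : ∀ {l l'} → l ≡ l' → vertex g₁ l' ≡ vertex g₂ l' → vertex g₁ l ≡ vertex g₂ l
    agree-at refl agree = agree

    disjoint : ∀ {j j'} → j ≤ suc k → 0 < j' → j' < suc k →
               vertex g₁ (i + j) ≢ vertex g₂ (i + j')
    disjoint {j} {j'} j≤K 0<j' j'<K eq =
      apart (m<m+n i 0<j') (subst (i + j' <_) i+K≡S (+-monoʳ-< i j'<K))
        (subst (λ l → vertex g₁ l ≡ vertex g₂ (i + j'))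
          (index-unique far g₁ g₂ (within j≤K) (within (<⇒≤ j'<K)) eq) eq)

  diverging-geodesics⇒polygon : ∀ {c z a} → DistGE c z (suc a) →
    (g₁ g₂ : WalkSeq c z (suc a)) → vertex g₁ a ≢ vertex g₂ a →
    Σ ℕ λ K → 2 ≤ K × K ≤ suc a × OrdinaryPolygon I K
  diverging-geodesics⇒polygon {a = a} far g₁ g₂ diverge
    with last-agreement (vertex g₁) (vertex g₂) (trans (start g₁) (sym (start g₂))) a
  ... | i , i≤a , meet , apart with m≤n⇒∃[o]m+o≡n (≤∧≢⇒< i≤a λ { refl → diverge meet })
  ...   | e , 1+i+e≡a =
    suc (suc e) , s≤s (s≤s z≤n) , subst (suc (suc e) ≤_) i+K≡1+a (m≤n+m _ i) ,
    rejoining-geodesics⇒polygon far g₁ g₂ i (suc e) i+K≡1+a meet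
      (λ i<l l<1+a → apart i<l (≤-pred l<1+a))
    where
    i+K≡1+a : i + suc (suc e) ≡ suc a
    i+K≡1+a = trans (+-suc i (suc e)) (cong suc (trans (+-suc i e) 1+i+e≡a))

module Girth {np nl : ℕ} (I : Incidence np nl) (n : ℕ)
  (no-small-polygon : ∀ k → 2 ≤ k → k < n → ¬ OrdinaryPolygon I k) where
  open Walks I
  open Geodesics I

  closer-neighbours-equal : ∀ {c z w₁ w₂ a} → suc a < n → DistGE c z (suc a) →
    Adj I w₁ z → Adj I w₂ z → DistLE I c w₁ a → DistLE I c w₂ a → w₁ ≡ w₂
  closer-neighbours-equal {c} {z} {w₁} {w₂} {a} 1+a<n far e₁ e₂ d₁ d₂ =
    decidable-stable (w₁ ≟E w₂) λ w₁≢w₂ →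
      let K , 2≤K , K≤1+a , polygon =
            diverging-geodesics⇒polygon far (through e₁ d₁) (through e₂ d₂) λ eq →
              w₁≢w₂ (trans (sym (through-penultimate e₁ d₁)) (trans eq (through-penultimate e₂ d₂)))
      in no-small-polygon K 2≤K (≤-<-trans K≤1+a 1+a<n) polygon
    where
    exact : ∀ {w} → Adj I w z → DistLE I c w a → Walk I c w a
    exact e (j , j≤a , walk) with ≤-antisym j≤a (≤-pred (far _ (walk ∷ʳ e)))
    ... | refl = walk

    through : ∀ {w} → Adj I w z → DistLE I c w a → WalkSeq c z (suc a)
    through e d = toWalkSeq (exact e d ∷ʳ e)

    through-penultimate : ∀ {w} (e : Adj I w z) (d : DistLE I c w a) →
                          WalkSeq.vertex (through e d) a ≡ w
    through-penultimate e d = vertexAt-penultimate (exact e d) e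

  -- Otherwise δ(c,z) = a + 2 by parity, and K ≠ M would be two neighbours of z within a + 1 of c.
  near-line-point-closer : ∀ {b c K z M a} → suc (suc b) < n →
    Walk I (pt c) (ln K) (suc a) → DistGE (pt c) (ln K) b →
    T (I z K) → M ≢ K → T (I z M) → DistLE I (pt c) (ln M) b → DistLE I (pt c) (pt z) a
  near-line-point-closer {b} {c} {K} {z} {M} {a} b+2<n walk far zK M≢K zM cM =
    decidable-stable (DistLE? (pt c) (pt z) a) λ ¬cz →
      let z-far = DistGE-past-neighbour {y = pt z} walk zK (¬DistLE⇒DistGE ¬cz)
          j , j≤1+b , cz = DistLE-∷ʳ {y = ln M} {z = pt z} cM zM
          2+a<n = ≤-<-trans (≤-trans (z-far j cz) j≤1+b) (≤-<-trans (n≤1+n _) b+2<n)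
      in M≢K (inj₂-injective (closer-neighbours-equal {w₁ = ln M} {w₂ = ln K} 2+a<n z-far zM zK
               (DistLE-mono (far _ walk) cM) (suc a , ≤-refl , walk)))

  near-line-point-unique : ∀ {b c K y y' N N'} → suc (suc b) < n → DistGE (pt c) (ln K) b →
    T (I y K) → N ≢ K → T (I y N) → DistLE I (pt c) (ln N) b →
    T (I y' K) → N' ≢ K → T (I y' N') → DistLE I (pt c) (ln N') b → y ≡ y'
  near-line-point-unique {b} {c} {K} {y} {y'} {N} b+2<n far yK N≢K yN cN y'K N'≢K y'N' cN'
    with shortest (DistLE-∷ʳ {z = ln K} (DistLE-∷ʳ {y = ln N} {z = pt y} cN yN) yK)
  ... | zero  , _ , () , _
  ... | suc a , D≤b+2 , walk , minimal = inj₁-injective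
    (closer-neighbours-equal {w₁ = pt y} {w₂ = pt y'} (≤-<-trans D≤b+2 b+2<n) minimal yK y'K
      (near-line-point-closer b+2<n walk far yK N≢K yN cN)
      (near-line-point-closer b+2<n walk far y'K N'≢K y'N' cN'))

module Construction {np nl : ℕ} (I : Incidence np nl) (n s : ℕ)
  (no-small-polygon : ∀ k → 2 ≤ k → k < n → ¬ OrdinaryPolygon I k)
  (another-line : ∀ x K → Σ (Fin nl) λ N → N ≢ K × T (I x N))
  (points-on : ∀ K → Fin (suc s) ↔ Σ (Fin np) λ p → T (I p K))
  (C : Subset np) (∣C∣≤s : ∣ C ∣ < suc s) (L : Fin nl) where
  open Walks I
  open Girth I n no-small-polygon

  Confined : E → ℕ → Set
  Confined e r = ∀ p → p ∈ C → DistLE I (pt p) e r → T (I p L)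

  Exposed : ℕ → Fin nl → Fin np → Set
  Exposed b K x = Σ (Fin np) λ c → c ∈ C × ¬ T (I c L) ×
                  Σ (Fin nl) λ N → N ≢ K × T (I x N) × DistLE I (pt c) (ln N) b

  Exposed? : ∀ b K x → Dec (Exposed b K x)
  Exposed? b K x = Finₚ.any? λ c → c ∈? C ×-dec ¬? (T? (I c L)) ×-dec
                   Finₚ.any? λ N → ¬? (N Fin.≟ K) ×-dec T? (I x N) ×-dec DistLE? (pt c) (ln N) b

  point : ∀ K → Fin (suc s) → Fin np
  point K a = proj₁ (Inverse.to (points-on K) a)

  point-on : ∀ K a → T (I (point K a) K)
  point-on K a = proj₂ (Inverse.to (points-on K) a)

  point-injective : ∀ K {a a'} → point K a ≡ point K a' → a ≡ a'
  point-injective K eq = Injection.injective (↔⇒↣ (points-on K)) (Σ-≡ eq)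
    where
    Σ-≡ : ∀ {u v : Σ (Fin np) λ p → T (I p K)} → proj₁ u ≡ proj₁ v → u ≡ v
    Σ-≡ {p , _} {_ , _} refl = cong (p ,_) (T-irrelevant _ _)

  unexposed-point : ∀ {b} K → suc (suc b) < n →
    (∀ {c} → c ∈ C → ¬ T (I c L) → DistGE (pt c) (ln K) b) →
    Σ (Fin np) λ x → T (I x K) × ¬ Exposed b K x
  unexposed-point {b} K b+2<n far with Finₚ.all? (λ a → Exposed? b K (point K a))
  ... | no ¬all = let a , unexposed = Finₚ.¬∀⟶∃¬ _ _ (λ a → Exposed? b K (point K a)) ¬all
                  in point K a , point-on K a , unexposed
  ... | yes all =
    contradiction (injection⇒≤∣∣ C witness (λ a → proj₁ (proj₂ (all a))) witness-injective)
                  (<⇒≱ ∣C∣≤s)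
    where
    witness : Fin (suc s) → Fin np
    witness a = proj₁ (all a)

    same-witness⇒same-point : ∀ {x x'} → T (I x K) → T (I x' K) →
      (e : Exposed b K x) (e' : Exposed b K x') → proj₁ e ≡ proj₁ e' → x ≡ x'
    same-witness⇒same-point xK x'K (c , c∈C , c∉L , N , N≢K , xN , cN)
                                   (_ , _ , _ , N' , N'≢K , x'N' , cN') refl =
      near-line-point-unique b+2<n (far c∈C c∉L) xK N≢K xN cN x'K N'≢K x'N' cN'

    witness-injective : ∀ {a a'} → witness a ≡ witness a' → a ≡ a'
    witness-injective {a} {a'} eq =
      point-injective K (same-witness⇒same-point (point-on K a) (point-on K a') (all a) (all a') eq)

  Confined-far : ∀ {K} i → Confined (ln K) (suc (2 * i)) →
    ∀ {c} → c ∈ C → ¬ T (I c L) → DistGE (pt c) (ln K) (suc (2 * suc i))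
  Confined-far i confined c∈C c∉L = point-line-DistGE (suc i)
    (subst (DistGE _ _) (sym (*-suc 2 i)) (¬DistLE⇒DistGE (c∉L ∘ confined _ c∈C)))

  Confined-start : Confined (ln L) 1
  Confined-start p _ (zero , _ , ())
  Confined-start p _ (suc zero , _ , step pL here) = pL
  Confined-start p _ (suc (suc _) , s≤s () , _)

  Confined-line : ∀ {b K x N} → ¬ Exposed b K x → N ≢ K → T (I x N) → Confined (ln N) b
  Confined-line unexposed N≢K xN p p∈C pN = decidable-stable (T? (I p L)) λ p∉L →
    unexposed (p , p∈C , p∉L , _ , N≢K , xN , pN)

  Confined-point : ∀ {r K x} → Confined (ln K) (suc r) → T (I x K) → ¬ Exposed (suc r) K x →
    Confined (pt x) (suc (suc r))
  Confined-point confined xK unexposed p p∈C (zero , _ , here) =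
    confined p p∈C (1 , s≤s z≤n , step xK here)
  Confined-point {K = K} confined xK unexposed p p∈C (suc j , s≤s j≤1+r , walk)
    with unsnoc walk
  ... | inj₁ _ , _ , ()
  ... | inj₂ N , walk′ , xN with N Fin.≟ K
  ...   | yes refl = confined p p∈C (j , j≤1+r , walk′)
  ...   | no  N≢K  = decidable-stable (T? (I p L)) λ p∉L →
    unexposed (p , p∈C , p∉L , N , N≢K , xN , (j , j≤1+r , walk′))

  line-stage : ∀ i → 3 + 2 * i < n →
    Σ (Fin nl) λ K → DistLE I (ln L) (ln K) (2 * i) × Confined (ln K) (suc (2 * i))
  line-stage zero    _     = L , DistLE-refl , Confined-start
  line-stage (suc i) bound =
    let K , L-K , confined = line-stage i (<-trans (+-monoʳ-< 3 (*-monoʳ-< 2 (n<1+n i))) bound)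
        x , xK , unexposed = unexposed-point K bound (Confined-far i confined)
        N , N≢K , xN       = another-line x K
    in N , subst (DistLE I (ln L) (ln N)) (sym (*-suc 2 i)) (DistLE-∷ʳ (DistLE-∷ʳ {z = pt x} L-K xK) xN)
         , Confined-line unexposed N≢K xN

  point-stage : ∀ i → 3 + 2 * i < n →
    Σ (Fin np) λ x → DistLE I (ln L) (pt x) (suc (2 * i)) × Confined (pt x) (suc (suc (2 * i)))
  point-stage i bound =
    let K , L-K , confined = line-stage i bound
        x , xK , unexposed = unexposed-point K bound λ c∈C c∉L →
          DistGE-weaken (s≤s (*-monoʳ-≤ 2 (n≤1+n i))) (Confined-far i confined c∈C c∉L)
    in x , DistLE-∷ʳ L-K xK , Confined-point confined xK unexposed

  Confined⇒⇔ : ∀ {e r} → DistLE I (ln L) e r → Confined e (suc r) →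
    ∀ p → ((p ∈ C) × DistLE I (pt p) e (suc r)) ⇔ ((p ∈ C) × T (I p L))
  Confined⇒⇔ L-e confined p = mk⇔ (λ (p∈C , near) → p∈C , confined p p∈C near)
                                   (λ (p∈C , pL) → p∈C , DistLE-∷ pL L-e)

stage-bound : ∀ {i m} → suc i ≤ m ∸ 1 → 3 + 2 * i < 2 * m
stage-bound {i} {suc m} 1+i≤m =
  subst (_≤ 2 * suc m) (trans (*-suc 2 (suc i)) (cong (2 +_) (*-suc 2 i))) (*-monoʳ-≤ 2 (s≤s 1+i≤m))

lemma2p6 : (np nl : ℕ) (I : Incidence np nl) (m s t : ℕ) → 2 ≤ m →
    WeakGenPolygon I (2 * m) → HasOrder I s t →
    (C : Subset np) → ∣ C ∣ < suc s →
    (d : ℕ) → 1 ≤ d → d ≤ m ∸ 1 →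
    ((L : Fin nl) → Σ (Fin nl) λ M →
        DistLE I (ln L) (ln M) (2 * d ∸ 2) ×
        (∀ p → ((p ∈ C) × DistLE I (pt p) (ln M) (2 * d ∸ 1)) ⇔ ((p ∈ C) × T (I p L))))
    ×
    ((L : Fin nl) → Σ (Fin np) λ v →
        DistLE I (pt v) (ln L) (2 * d ∸ 1) ×
        (∀ p → ((p ∈ C) × DistLE I (pt p) (pt v) (2 * d)) ⇔ ((p ∈ C) × T (I p L))))
lemma2p6 np nl I m s t 2≤m Γ (points-on , _) C ∣C∣≤s zero () _
-- The goal shows 2 * suc i normalised to suc (i + suc (i + 0)); the rewrite turns it into
-- suc (suc (2 * i)), so that 2 * d ∸ 2 and 2 * d ∸ 1 compute to 2 * i and suc (2 * i).
lemma2p6 np nl I m s t 2≤m Γ (points-on , _) C ∣C∣≤s (suc i) _ 1+i≤m∸1 rewrite +-suc i (i + 0) =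
  (λ L → let K , L-K , confined = line-stage L i bound in
         K , L-K , Confined⇒⇔ L L-K confined) ,
  (λ L → let x , L-x , confined = point-stage L i bound in
         x , DistLE-sym L-x , Confined⇒⇔ L L-x confined)
  where
  open Walks I
  open Polygons I using (another-line)
  open Construction I (2 * m) s (WeakGenPolygon.noSmall Γ)
    (another-line (≤-trans 2≤m (m≤m+n m _)) λ x →
       map₂ proj₁ (WeakGenPolygon.twoInGon Γ (pt x) (pt x)))
    points-on C ∣C∣≤s

  bound : 3 + 2 * i < 2 * m
  bound = stage-bound {m = m} 1+i≤m∸1
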